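{- If $Y$ is a generalized truncation of a multigraph $X$, then $\kappa'(Y)\leq\kappa'(X)$.
   Context: A multigraph may have multiple edges but no loops; it is assumed to have no isolated vertices. Generalized truncation of $X$: take a matching $M_0$ with $|M_0|=|E(X)|$ (on $2|E(X)|$ new vertices) and a bijection $F:E(X)\to M_0$; for each edge $e$ of $X$ with ends $u,v$, label one end of $F(e)$ by $u$ and the other by $v$. For $v\in V(X)$, the cluster $\mathrm{cl}(v)$ is the set of vertices labelled $v$; insert an arbitrary graph $\mathrm{con}(v)$ on $\mathrm{cl}(v)$. The graph $F(M_0)\cup\bigcup_v\mathrm{con}(v)$ (or any graph isomorphic to it) is a generalized truncation of $X$. $\kappa'$ denotes edge connectivity: the minimum number of edges whose deletion disconnects the multigraph (equal to $0$ if it is disconnected). -}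

module Defs where

open import Data.Nat using (ℕ; _+_; _≤_)
open import Data.Fin using (Fin; splitAt)
open import Data.Fin.Subset using (Subset; _∉_; ∣_∣)
open import Data.Bool using (Bool; true; false)
open import Data.Product using (Σ; ∃; _×_; _,_; proj₁; proj₂; swap)
open import Data.Sum using (_⊎_; [_,_]′)
open import Relation.Nullary using (¬_)
open import Relation.Binary.PropositionalEquality using (_≡_; _≢_)

-- A finite family of edges (multiple edges allowed) over a vertex type V.
-- Edge i has ends (proj₁ (ends i)) and (proj₂ (ends i)); edges are undirected.
record EdgeGraph (V : Set) : Set where
  field
    nE   : ℕ
    ends : Fin nE → V × V
open EdgeGraph public

data Reach {V : Set} (G : EdgeGraph V) (S : Subset (nE G)) : V → V → Set where
  here : ∀ {u} → Reach G S u u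
  step : ∀ {u v w} (e : Fin (nE G)) → e ∉ S →
         (ends G e ≡ (u , v) ⊎ ends G e ≡ (v , u)) →
         Reach G S v w → Reach G S u w

Connected : {V : Set} (G : EdgeGraph V) → Subset (nE G) → Set
Connected G S = ∀ u v → Reach G S u v

Disconnecting : {V : Set} → EdgeGraph V → ℕ → Set
Disconnecting G k = Σ (Subset (nE G)) λ S → ∣ S ∣ ≡ k × ¬ Connected G S

-- κ'(G) = k : k is the minimum number of edges whose deletion disconnects G
-- (k = 0 iff G is already disconnected).
IsEdgeConnectivity : {V : Set} → EdgeGraph V → ℕ → Set
IsEdgeConnectivity G k = Disconnecting G k × (∀ j → Disconnecting G j → k ≤ j)

record Multigraph : Set where
  field
    nV         : ℕ
    graph      : EdgeGraph (Fin nV)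
    loopless   : ∀ e → proj₁ (ends graph e) ≢ proj₂ (ends graph e)
    noIsolated : ∀ v → ∃ λ e → proj₁ (ends graph e) ≡ v ⊎ proj₂ (ends graph e) ≡ v
open Multigraph public

-- Vertices of the matching M₀: edge e of X gives the two vertices (e , false), (e , true).
TVertex : Multigraph → Set
TVertex X = Fin (nE (graph X)) × Bool

label : (X : Multigraph) → TVertex X → Fin (nV X)
label X (e , false) = proj₁ (ends (graph X) e)
label X (e , true)  = proj₂ (ends (graph X) e)

-- The union of the graphs con(v): a simple graph on TVertex X all of whose
-- edges lie inside a cluster cl(v) (both ends carry the same label).
record ConGraph (X : Multigraph) : Set where
  field
    nC        : ℕ
    cends     : Fin nC → TVertex X × TVertex X
    inCluster : ∀ i → label X (proj₁ (cends i)) ≡ label X (proj₂ (cends i))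
    noLoop    : ∀ i → proj₁ (cends i) ≢ proj₂ (cends i)
    simple    : ∀ i j → (cends i ≡ cends j ⊎ cends i ≡ swap (cends j)) → i ≡ j
open ConGraph public

-- The generalized truncation Y = F(M₀) ∪ ⋃ con(v).
truncation : (X : Multigraph) → ConGraph X → EdgeGraph (TVertex X)
truncation X C = record
  { nE   = nE (graph X) + nC C
  ; ends = λ i → [ (λ e → (e , false) , (e , true)) , cends C ]′ (splitAt (nE (graph X)) i)
  }

-- Extend a disconnecting edge set S of X to Y by keeping all edges of the graphs con(v).
-- Contracting every cluster cl(v) to v (the map label) sends each remaining edge of Y
-- either to a single vertex or to an edge of X outside S, so a walk in Y − S projects
-- to a walk in X − S; since no vertex of X is isolated, label is surjective, hence Y − S
-- is disconnected as well.
module Submission where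

open import Defs
open import Data.Nat using (ℕ; _≤_; suc)
open import Data.Fin using (Fin; splitAt; _↑ˡ_)
open import Data.Fin.Properties using (splitAt⁻¹-↑ˡ)
open import Data.Fin.Subset using (Subset; _∈_; _∉_; ∣_∣; ⊥; inside; outside)
open import Data.Fin.Subset.Properties using (∣⊥∣≡0)
open import Data.Vec using (_∷_; []; _++_)
open import Data.Vec.Properties using (lookup-++ˡ; []=⇒lookup; lookup⇒[]=)
open import Data.Bool using (true; false)
open import Data.Product using (Σ; _×_; _,_; proj₁; proj₂; map)
open import Data.Sum using (_⊎_; inj₁; inj₂)
open import Relation.Binary.PropositionalEquality
  using (_≡_; refl; sym; trans; cong; subst)

∣p++⊥∣≡∣p∣ : ∀ {m} (p : Subset m) n → ∣ p ++ ⊥ {n} ∣ ≡ ∣ p ∣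
∣p++⊥∣≡∣p∣ []            n = ∣⊥∣≡0 n
∣p++⊥∣≡∣p∣ (inside  ∷ p) n = cong suc (∣p++⊥∣≡∣p∣ p n)
∣p++⊥∣≡∣p∣ (outside ∷ p) n = ∣p++⊥∣≡∣p∣ p n

x∈p⇒x↑ˡ∈p++q : ∀ {m n} {x : Fin m} (p : Subset m) (q : Subset n) → x ∈ p → x ↑ˡ n ∈ p ++ q
x∈p⇒x↑ˡ∈p++q {n = n} {x} p q x∈p =
  lookup⇒[]= (x ↑ˡ n) (p ++ q) (trans (lookup-++ˡ p q x) ([]=⇒lookup x∈p))

module _ {V W : Set} (f : V → W) (G : EdgeGraph V) (S : Subset (nE G))
                                 (H : EdgeGraph W) (T : Subset (nE H)) where

  MapsEdges : Set
  MapsEdges = ∀ e → e ∉ S →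
    f (proj₁ (ends G e)) ≡ f (proj₂ (ends G e)) ⊎
    Σ (Fin (nE H)) λ e′ → e′ ∉ T × ends H e′ ≡ map f f (ends G e)

  Reach-map : MapsEdges → ∀ {u v} → Reach G S u v → Reach H T (f u) (f v)
  Reach-map maps here = here
  Reach-map maps {v = t} (step e e∉S uv r) with ends G e | maps e e∉S | uv
  ... | _ | inj₁ fu≡fv            | inj₁ refl = subst (λ a → Reach H T a (f t)) (sym fu≡fv) (Reach-map maps r)
  ... | _ | inj₁ fv≡fu            | inj₂ refl = subst (λ a → Reach H T a (f t)) fv≡fu (Reach-map maps r)
  ... | _ | inj₂ (e′ , e′∉T , eq) | inj₁ refl = step e′ e′∉T (inj₁ eq) (Reach-map maps r)
  ... | _ | inj₂ (e′ , e′∉T , eq) | inj₂ refl = step e′ e′∉T (inj₂ eq) (Reach-map maps r)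

  Connected-map : MapsEdges → (∀ w → Σ V λ v → f v ≡ w) → Connected G S → Connected H T
  Connected-map maps surj conn w w′ with surj w | surj w′
  ... | v , refl | v′ , refl = Reach-map maps (conn v v′)

label-surjective : (X : Multigraph) → ∀ v → Σ (TVertex X) λ a → label X a ≡ v
label-surjective X v with noIsolated X v
... | e , inj₁ first  = (e , false) , first
... | e , inj₂ second = (e , true)  , second

module _ (X : Multigraph) (C : ConGraph X) where

  extend : Subset (nE (graph X)) → Subset (nE (truncation X C))
  extend S = S ++ ⊥

  label-mapsEdges : ∀ S → MapsEdges (label X) (truncation X C) (extend S) (graph X) S
  label-mapsEdges S e e∉S′ with splitAt (nE (graph X)) e in split
  ... | inj₁ i = inj₂ (i , i∉S , refl)
    where
    i∉S : i ∉ S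
    i∉S i∈S = e∉S′ (subst (_∈ extend S) (splitAt⁻¹-↑ˡ split) (x∈p⇒x↑ˡ∈p++q S ⊥ i∈S))
  ... | inj₂ j = inj₁ (inCluster C j)

theorem3p2 : (X : Multigraph) (C : ConGraph X) (kX kY : ℕ) →
               IsEdgeConnectivity (graph X) kX →
               IsEdgeConnectivity (truncation X C) kY →
               kY ≤ kX
theorem3p2 X C kX kY ((S , ∣S∣≡kX , disconnectedX) , _) (_ , minimalY) =
  minimalY kX (extend X C S , trans (∣p++⊥∣≡∣p∣ S (nC C)) ∣S∣≡kX ,
               λ connectedY → disconnectedX
                 (Connected-map (label X) _ _ _ _ (label-mapsEdges X C S)
                                (label-surjective X) connectedY))
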